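{- For any integer $d\ge17$ there exists a matroid $\mathcal{M}$ of rank $d$ that is $k$-coverable for some $k\ge d$, but that cannot be reduced to a $2k$-coverable partition matroid with the same ground set (the same number of elements). In particular, such an $\mathcal{M}$ can only be reduced to partition matroids on the same ground set that are $\Omega(kd)$-coverable and no better, i.e. every partition matroid on the same ground set that is a reduction of $\mathcal{M}$ has covering number $\Omega(kd)$.
   Context: The covering number of a loopless matroid $\mathcal{M}=(E,\mathcal{I})$ is the minimum number of independent sets of $\mathcal{M}$ whose union is $E$; $\mathcal{M}$ is $k$-coverable if its covering number is at most $k$. A matroid $\mathcal{M}'=(E',\mathcal{I}')$ is a reduction of $\mathcal{M}=(E,\mathcal{I})$ if $E'\subseteq E$ and $\mathcal{I}'\subseteq\mathcal{I}$. A partition matroid with parts $P_1,\dots,P_m$ has ground set the disjoint union of the $P_i$, and $S$ is independent iff $|S\cap P_i|\le1$ for all $i$. The $\Omega(\cdot)$ hides an absolute positive constant independent of $d$ and $k$. -}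

module Defs where

open import Data.Nat using (ℕ; _≤_; _<_)
open import Data.Fin using (Fin)
open import Data.Fin.Subset using (Subset; ⊥; ⁅_⁆; _∪_; _∈_; _∉_; _⊆_; ∣_∣)
open import Data.Product using (Σ; ∃; _×_)
open import Relation.Binary.PropositionalEquality using (_≡_)

record Matroid (n : ℕ) : Set₁ where
  field
    Indep        : Subset n → Set
    indep-empty  : Indep ⊥
    indep-subset : ∀ {A B} → A ⊆ B → Indep B → Indep A
    indep-exch   : ∀ {A B} → Indep A → Indep B → ∣ A ∣ < ∣ B ∣ →
                   ∃ λ x → x ∈ B × x ∉ A × Indep (A ∪ ⁅ x ⁆)
open Matroid public

HasRank : ∀ {n} → Matroid n → ℕ → Set
HasRank M d = (∃ λ A → Indep M A × ∣ A ∣ ≡ d) × (∀ A → Indep M A → ∣ A ∣ ≤ d)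

Coverable : ∀ {n} → Matroid n → ℕ → Set
Coverable {n} M k =
  Σ (Fin k → Subset n) λ F → (∀ i → Indep M (F i)) × (∀ x → ∃ λ i → x ∈ F i)

IsReductionOf : ∀ {n} → Matroid n → Matroid n → Set
IsReductionOf M' M = ∀ S → Indep M' S → Indep M S

-- partition matroid with parts P_i = f⁻¹(i), i : Fin m:
-- S independent iff |S ∩ P_i| ≤ 1 for all i, i.e. f is injective on S
PartIndep : ∀ {n m} → (Fin n → Fin m) → Subset n → Set
PartIndep f S = ∀ x y → x ∈ S → y ∈ S → f x ≡ f y → x ≡ y

IsPartitionMatroid : ∀ {n} → Matroid n → Set
IsPartitionMatroid {n} P =
  ∃ λ m → Σ (Fin n → Fin m) λ f →
    ∀ S → (Indep P S → PartIndep f S) × (PartIndep f S → Indep P S)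

-- Choose q with 2^q ≤ d < 2^(q+1) and let M be the binary matroid of the affine points
-- (1, y, z), y ∈ F₂^q, z ∈ F₂^d, truncated to rank d; its ground set F₂^(q+d) has
-- n = 2^q·2^d elements. The unit vectors (0, e_i) show that M has rank d. Fix an injection
-- slot : F₂^q → [d]; for each h ∈ F₂^d the 2^q points (y, h + e_slot(y)) are independent,
-- since (y, h + e_slot(y)) is the only one of them whose coordinate slot(y) differs from that
-- of h, and these 2^d blocks cover the ground set, so M is k-coverable for k = 2^d.
-- The affine points of 0, x, y and x + y sum to zero, so a partition reduction of M must put
-- two of them into the same part. Each part meets each of the j sets of a cover at most once,
-- so counting such pairs over all (x, y) gives n² ≤ 6nj. Hence j ≥ 2^q·2^d/6 > kd/12, and
-- since 2^q ≥ 16 this also rules out j = 2k.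
module Submission where

open import Defs
open import Algebra using (CommutativeRing)
import Algebra.Properties.CommutativeSemigroup as CommutativeSemigroupProperties
open import Data.Bool using (Bool; true; false; _xor_; _∧_; if_then_else_)
open import Data.Bool.Properties
  using (xor-comm; xor-assoc; xor-identityˡ; xor-identityʳ; xor-same; xor-∧-commutativeRing;
         ∧-distribˡ-xor; ∧-zeroʳ; ∧-identityʳ)
  renaming (_≟_ to _≟ᵇ_)
open import Data.Empty using (⊥-elim)
open import Data.Fin using (Fin; zero; suc; _↑ʳ_; inject≤)
open import Data.Fin.Permutation using (permutation)
open import Data.Fin.Properties
  using (any?; suc-injective; 0≢1+n; *↔×; 2↔Bool; inject≤-injective)
  renaming (_≟_ to _≟ᶠ_)
open import Data.Fin.Subset
  using (Subset; inside; outside; ⊥; ⁅_⁆; _∪_; _─_; _-_; _∈_; _∉_; _⊆_; ∣_∣)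
open import Data.Fin.Subset.Properties
  using (_∈?_; ∉⊥; x∈⁅x⁆; x∈⁅y⁆⇒x≡y; x∈p∪q⁻; x∈p∪q⁺; p⊆p∪q; p─q⊆p; p⊆q⇒∣p∣≤∣q∣;
         x∈p∧x∉q⇒x∈p─q; x∈p∧x≢y⇒x∈p-y; x∉⁅y⁆⇒x≢y; x∈p⇒∣p-x∣<∣p∣; Empty-unique; p─⊥≡p; ∪-identityʳ;
         ⊆-min; ⊆-antisym; ∣⊥∣≡0; anySubset?; _⊆?_)
open import Data.Nat using (ℕ; zero; suc; _+_; _*_; _^_; _≤_; _<_; z≤n; s≤s; NonZero)
open import Data.Nat.Induction using (<-wellFounded)
open import Data.Nat.Properties
  using (≤-refl; ≤-trans; ≤-reflexive; <⇒≤; <-≤-trans; ≤-<-trans; <⇒≱; ≮⇒≥; <-irrefl;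
         m≤n⇒m<n∨m≡n; m≤n⇒m≤1+n; m≤m+n; m≤n+m; m<m+n; 0<1+n; +-mono-≤; *-monoˡ-≤; *-monoʳ-≤;
         *-monoˡ-<; *-cancelˡ-≤; *-assoc; *-zeroʳ; *-identityʳ; m^n>0; m^n≢0; ^-monoʳ-≤;
         ^-distribˡ-+-*; +-0-commutativeMonoid; module ≤-Reasoning)
open import Data.Nat.Tactic.RingSolver using (solve-∀)
open import Data.Product using (Σ; ∃; _×_; _,_; proj₁; proj₂)
open import Data.Product.Function.NonDependent.Propositional using (_×-↔_)
open import Data.Sum using (_⊎_; inj₁; inj₂)
open import Data.Vec using (Vec; []; _∷_; lookup; replicate; zipWith; _++_; take; drop; here; there)
open import Data.Vec.Properties
  using (lookup-zipWith; lookup-replicate; ≡-dec; lookup-++ʳ; ++-injectiveˡ; ++-injectiveʳ;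
         take++drop≡id)
open import Data.Vec.Relation.Binary.Pointwise.Inductive
  using (Pointwise-≡⇒≡; zipWith-comm; zipWith-assoc; zipWith-identityˡ; zipWith-identityʳ)
open import Function using (_∘_; case_of_)
open import Function.Bundles using (_↔_; mk↔ₛ′; Inverse)
open import Function.Construct.Composition using (_↔-∘_)
open import Function.Definitions using (Injective)
open import Induction.WellFounded using (Acc; acc)
open import Level using (0ℓ)
open import Relation.Nullary using (¬_; Dec; yes; no; does; contradiction)
open import Relation.Nullary.Decidable using (_×-dec_; ¬?; dec-true; dec-false; map′; does-≡)
open import Relation.Unary using (Pred; Decidable)
open import Relation.Binary.PropositionalEquality
  using (_≡_; _≢_; refl; sym; trans; cong; cong₂; subst; module ≡-Reasoning)
open import Algebra.Properties.CommutativeMonoid.Sum +-0-commutativeMonoid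
  using (sum; sum-syntax; sum-cong-≗; ∑-comm; ∑-distrib-+; sum-permute)

open CommutativeSemigroupProperties (CommutativeRing.+-commutativeSemigroup xor-∧-commutativeRing)
  using () renaming (interchange to xor-interchange)

infixl 6 _⊕_

_⊕_ : ∀ {D} → Vec Bool D → Vec Bool D → Vec Bool D
_⊕_ = zipWith _xor_

𝟘 : ∀ {D} → Vec Bool D
𝟘 = replicate _ false

⊕-comm : ∀ {D} (u v : Vec Bool D) → u ⊕ v ≡ v ⊕ u
⊕-comm u v = Pointwise-≡⇒≡ (zipWith-comm xor-comm u v)

⊕-assoc : ∀ {D} (u v t : Vec Bool D) → u ⊕ v ⊕ t ≡ u ⊕ (v ⊕ t)
⊕-assoc u v t = Pointwise-≡⇒≡ (zipWith-assoc xor-assoc u v t)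

⊕-identityˡ : ∀ {D} (u : Vec Bool D) → 𝟘 ⊕ u ≡ u
⊕-identityˡ u = Pointwise-≡⇒≡ (zipWith-identityˡ xor-identityˡ u)

⊕-identityʳ : ∀ {D} (u : Vec Bool D) → u ⊕ 𝟘 ≡ u
⊕-identityʳ u = Pointwise-≡⇒≡ (zipWith-identityʳ xor-identityʳ u)

⊕-self : ∀ {D} (u : Vec Bool D) → u ⊕ u ≡ 𝟘
⊕-self []      = refl
⊕-self (a ∷ u) = cong₂ _∷_ (xor-same a) (⊕-self u)

⊕-interchange : ∀ {D} (u v s t : Vec Bool D) → (u ⊕ v) ⊕ (s ⊕ t) ≡ (u ⊕ s) ⊕ (v ⊕ t)
⊕-interchange []      []      []      []      = refl
⊕-interchange (a ∷ u) (b ∷ v) (c ∷ s) (e ∷ t) =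
  cong₂ _∷_ (xor-interchange a b c e) (⊕-interchange u v s t)

⊕-cancelˡ : ∀ {D} (u v : Vec Bool D) → u ⊕ (u ⊕ v) ≡ v
⊕-cancelˡ u v = begin
  u ⊕ (u ⊕ v) ≡⟨ ⊕-assoc u u v ⟨
  u ⊕ u ⊕ v   ≡⟨ cong (_⊕ v) (⊕-self u) ⟩
  𝟘 ⊕ v       ≡⟨ ⊕-identityˡ v ⟩
  v           ∎
  where open ≡-Reasoning

⊕-cancelʳ : ∀ {D} (u v : Vec Bool D) → u ⊕ v ⊕ v ≡ u
⊕-cancelʳ u v = trans (⊕-assoc u v v) (trans (cong (u ⊕_) (⊕-self v)) (⊕-identityʳ u))

⊕-swapˡ : ∀ {D} (u v t : Vec Bool D) → u ⊕ (v ⊕ t) ≡ v ⊕ (u ⊕ t)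
⊕-swapˡ u v t = begin
  u ⊕ (v ⊕ t) ≡⟨ ⊕-assoc u v t ⟨
  u ⊕ v ⊕ t   ≡⟨ cong (_⊕ t) (⊕-comm u v) ⟩
  v ⊕ u ⊕ t   ≡⟨ ⊕-assoc v u t ⟩
  v ⊕ (u ⊕ t) ∎
  where open ≡-Reasoning

⊕≡𝟘⇒≡ : ∀ {D} {u v : Vec Bool D} → u ⊕ v ≡ 𝟘 → u ≡ v
⊕≡𝟘⇒≡ {u = u} {v} eq = trans (sym (⊕-cancelʳ u v)) (trans (cong (_⊕ v) eq) (⊕-identityˡ v))

lookup-⊕ : ∀ {D} (u v : Vec Bool D) i → lookup (u ⊕ v) i ≡ lookup u i xor lookup v i
lookup-⊕ u v i = lookup-zipWith _xor_ i u v

lookup-⁅⁆ : ∀ {N} (x y : Fin N) → lookup ⁅ y ⁆ x ≡ does (x ≟ᶠ y)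
lookup-⁅⁆ zero    zero    = refl
lookup-⁅⁆ zero    (suc y) = refl
lookup-⁅⁆ (suc x) zero    = lookup-replicate x false
lookup-⁅⁆ (suc x) (suc y) = lookup-⁅⁆ x y

-- Subsets of Fin N are bit vectors, and _⊕_ on them is symmetric difference.

x∈p⊕q⁻ : ∀ {N} {x : Fin N} (p q : Subset N) → x ∈ p ⊕ q → x ∈ p ⊎ x ∈ q
x∈p⊕q⁻ (inside  ∷ p) (outside ∷ q) here      = inj₁ here
x∈p⊕q⁻ (outside ∷ p) (inside  ∷ q) here      = inj₂ here
x∈p⊕q⁻ (_ ∷ p)       (_ ∷ q)       (there x∈) with x∈p⊕q⁻ p q x∈
... | inj₁ x∈p = inj₁ (there x∈p)
... | inj₂ x∈q = inj₂ (there x∈q)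

x∈p⊕q⁺ : ∀ {N} {x : Fin N} {p q : Subset N} → x ∈ p → x ∉ q → x ∈ p ⊕ q
x∈p⊕q⁺ {q = outside ∷ q} here        x∉q = here
x∈p⊕q⁺ {q = inside  ∷ q} here        x∉q = contradiction here x∉q
x∈p⊕q⁺ {q = _ ∷ q}       (there x∈p) x∉q = there (x∈p⊕q⁺ x∈p (x∉q ∘ there))

p⊕q⊆r : ∀ {N} {p q r : Subset N} → p ⊆ r → q ⊆ r → p ⊕ q ⊆ r
p⊕q⊆r {p = p} {q} p⊆r q⊆r x∈ with x∈p⊕q⁻ p q x∈
... | inj₁ x∈p = p⊆r x∈p
... | inj₂ x∈q = q⊆r x∈q

x∈p─q⇒x∉q : ∀ {N} {x : Fin N} (p q : Subset N) → x ∈ p ─ q → x ∉ q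
x∈p─q⇒x∉q (inside ∷ p) (outside ∷ q) here       ()
x∈p─q⇒x∉q (_ ∷ p)      (_ ∷ q)       (there x∈) (there x∈q) = x∈p─q⇒x∉q p q x∈ x∈q

x∈p-y⇒x≢y : ∀ {N} {x y : Fin N} (p : Subset N) → x ∈ p - y → x ≢ y
x∈p-y⇒x≢y {y = y} p x∈ = x∉⁅y⁆⇒x≢y (x∈p─q⇒x∉q p ⁅ y ⁆ x∈)

x∈p⇒⁅x⁆⊆p : ∀ {N} {x : Fin N} {p : Subset N} → x ∈ p → ⁅ x ⁆ ⊆ p
x∈p⇒⁅x⁆⊆p {x = x} x∈p y∈⁅x⁆ = subst (_∈ _) (sym (x∈⁅y⁆⇒x≡y x y∈⁅x⁆)) x∈p

∣p∪⁅x⁆∣≡1+∣p∣ : ∀ {N} {x : Fin N} (p : Subset N) → x ∉ p → ∣ p ∪ ⁅ x ⁆ ∣ ≡ suc ∣ p ∣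
∣p∪⁅x⁆∣≡1+∣p∣ {x = zero}  (inside  ∷ p) x∉p = contradiction here x∉p
∣p∪⁅x⁆∣≡1+∣p∣ {x = zero}  (outside ∷ p) x∉p = cong (suc ∘ ∣_∣) (∪-identityʳ p)
∣p∪⁅x⁆∣≡1+∣p∣ {x = suc x} (inside  ∷ p) x∉p = cong suc (∣p∪⁅x⁆∣≡1+∣p∣ p (x∉p ∘ there))
∣p∪⁅x⁆∣≡1+∣p∣ {x = suc x} (outside ∷ p) x∉p = ∣p∪⁅x⁆∣≡1+∣p∣ p (x∉p ∘ there)

∣r─q∣<∣p─q∣ : ∀ {N} {x : Fin N} {p q r : Subset N} → x ∈ p → x ∉ q → r ⊆ (p - x) ∪ q →
             ∣ r ─ q ∣ < ∣ p ─ q ∣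
∣r─q∣<∣p─q∣ {x = x} {p} {q} {r} x∈p x∉q r⊆ =
  ≤-<-trans (p⊆q⇒∣p∣≤∣q∣ r─q⊆) (x∈p⇒∣p-x∣<∣p∣ (x∈p∧x∉q⇒x∈p─q x∈p x∉q))
  where
  r─q⊆ : r ─ q ⊆ (p ─ q) - x
  r─q⊆ y∈ with x∈p∪q⁻ (p - x) q (r⊆ (p─q⊆p r q y∈))
  ... | inj₁ y∈p-x = x∈p∧x≢y⇒x∈p-y (x∈p∧x∉q⇒x∈p─q (p─q⊆p p _ y∈p-x) (x∈p─q⇒x∉q r q y∈))
                                    (x∈p-y⇒x≢y p y∈p-x)
  ... | inj₂ y∈q   = contradiction y∈q (x∈p─q⇒x∉q r q y∈)

⨁ : ∀ {N D} → Subset N → (Fin N → Vec Bool D) → Vec Bool D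
⨁ []            w = 𝟘
⨁ (inside  ∷ T) w = w zero ⊕ ⨁ T (w ∘ suc)
⨁ (outside ∷ T) w = ⨁ T (w ∘ suc)

module _ {D : ℕ} where

  ⨁-⊥ : ∀ {N} (w : Fin N → Vec Bool D) → ⨁ ⊥ w ≡ 𝟘
  ⨁-⊥ {zero}  w = refl
  ⨁-⊥ {suc N} w = ⨁-⊥ (w ∘ suc)

  ⨁-⁅⁆ : ∀ {N} (w : Fin N → Vec Bool D) x → ⨁ ⁅ x ⁆ w ≡ w x
  ⨁-⁅⁆ w zero    = trans (cong (w zero ⊕_) (⨁-⊥ (w ∘ suc))) (⊕-identityʳ (w zero))
  ⨁-⁅⁆ w (suc x) = ⨁-⁅⁆ (w ∘ suc) x

  ⨁-⊕ : ∀ {N} (w : Fin N → Vec Bool D) (T U : Subset N) → ⨁ (T ⊕ U) w ≡ ⨁ T w ⊕ ⨁ U w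
  ⨁-⊕ w []            []            = sym (⊕-self 𝟘)
  ⨁-⊕ w (inside  ∷ T) (inside  ∷ U) = begin
    ⨁ (T ⊕ U) (w ∘ suc)         ≡⟨ ⨁-⊕ (w ∘ suc) T U ⟩
    A ⊕ B                       ≡⟨ ⊕-identityˡ (A ⊕ B) ⟨
    𝟘 ⊕ (A ⊕ B)                 ≡⟨ cong (_⊕ (A ⊕ B)) (⊕-self (w zero)) ⟨
    w zero ⊕ w zero ⊕ (A ⊕ B)   ≡⟨ ⊕-interchange (w zero) (w zero) A B ⟩
    w zero ⊕ A ⊕ (w zero ⊕ B)   ∎
    where
    open ≡-Reasoning
    A = ⨁ T (w ∘ suc)
    B = ⨁ U (w ∘ suc)
  ⨁-⊕ w (inside  ∷ T) (outside ∷ U) =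
    trans (cong (w zero ⊕_) (⨁-⊕ (w ∘ suc) T U)) (sym (⊕-assoc (w zero) _ _))
  ⨁-⊕ w (outside ∷ T) (inside  ∷ U) =
    trans (cong (w zero ⊕_) (⨁-⊕ (w ∘ suc) T U)) (⊕-swapˡ (w zero) _ _)
  ⨁-⊕ w (outside ∷ T) (outside ∷ U) = ⨁-⊕ (w ∘ suc) T U

  ⨁-remove : ∀ {N} (w : Fin N → Vec Bool D) {T x} → x ∈ T → ⨁ T w ≡ w x ⊕ ⨁ (T - x) w
  ⨁-remove w {inside ∷ T} here = cong (λ S → w zero ⊕ ⨁ S (w ∘ suc)) (sym (p─⊥≡p T))
  ⨁-remove w {inside ∷ T} {suc x} (there x∈T) =
    trans (cong (w zero ⊕_) (⨁-remove (w ∘ suc) x∈T)) (⊕-swapˡ (w zero) (w (suc x)) _)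
  ⨁-remove w {outside ∷ T} (there x∈T) = ⨁-remove (w ∘ suc) x∈T

  ⨁-closed : ∀ {N} (P : Vec Bool D → Set) → P 𝟘 → (∀ {u v} → P u → P v → P (u ⊕ v)) →
             (w : Fin N → Vec Bool D) (T : Subset N) → (∀ {x} → x ∈ T → P (w x)) → P (⨁ T w)
  ⨁-closed P P𝟘 P⊕ w []            Pw = P𝟘
  ⨁-closed P P𝟘 P⊕ w (inside  ∷ T) Pw = P⊕ (Pw here) (⨁-closed P P𝟘 P⊕ (w ∘ suc) T (Pw ∘ there))
  ⨁-closed P P𝟘 P⊕ w (outside ∷ T) Pw = ⨁-closed P P𝟘 P⊕ (w ∘ suc) T (Pw ∘ there)

module LinearAlgebra {N D : ℕ} (w : Fin N → Vec Bool D) where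

  Independent : Subset N → Set
  Independent A = ∀ T → T ⊆ A → ⨁ T w ≡ 𝟘 → T ≡ ⊥

  infix 4 _∈⟨_⟩ _⊆⟨_⟩

  _∈⟨_⟩ : Vec Bool D → Subset N → Set
  v ∈⟨ A ⟩ = ∃ λ T → T ⊆ A × ⨁ T w ≡ v

  _⊆⟨_⟩ : Subset N → Subset N → Set
  B ⊆⟨ A ⟩ = ∀ {x} → x ∈ B → w x ∈⟨ A ⟩

  ∈⟨⟩-intro : ∀ {A v} T → T ⊆ A → ⨁ T w ≡ v → v ∈⟨ A ⟩
  ∈⟨⟩-intro T T⊆A ⨁T≡v = T , T⊆A , ⨁T≡v

  _∈⟨_⟩? : ∀ v A → Dec (v ∈⟨ A ⟩)
  v ∈⟨ A ⟩? = anySubset? (λ T → (T ⊆? A) ×-dec ≡-dec _≟ᵇ_ (⨁ T w) v)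

  unspanned? : ∀ B A → Dec (∃ λ b → b ∈ B × ¬ w b ∈⟨ A ⟩)
  unspanned? B A = any? (λ b → b ∈? B ×-dec ¬? (w b ∈⟨ A ⟩?))

  ⊆⟨⟩-unless-unspanned : ∀ {A B} → ¬ (∃ λ b → b ∈ B × ¬ w b ∈⟨ A ⟩) → B ⊆⟨ A ⟩
  ⊆⟨⟩-unless-unspanned {A} ∄b {x} x∈B with w x ∈⟨ A ⟩?
  ... | yes x∈⟨A⟩ = x∈⟨A⟩
  ... | no  x∉⟨A⟩ = contradiction (x , x∈B , x∉⟨A⟩) ∄b

  𝟘∈⟨⟩ : ∀ {A} → 𝟘 ∈⟨ A ⟩
  𝟘∈⟨⟩ {A} = ∈⟨⟩-intro ⊥ (⊆-min A) (⨁-⊥ w)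

  ⊕-∈⟨⟩ : ∀ {A u v} → u ∈⟨ A ⟩ → v ∈⟨ A ⟩ → u ⊕ v ∈⟨ A ⟩
  ⊕-∈⟨⟩ (T , T⊆A , refl) (U , U⊆A , refl) = ∈⟨⟩-intro (T ⊕ U) (p⊕q⊆r T⊆A U⊆A) (⨁-⊕ w T U)

  ∈⇒∈⟨⟩ : ∀ {A x} → x ∈ A → w x ∈⟨ A ⟩
  ∈⇒∈⟨⟩ {x = x} x∈A = ∈⟨⟩-intro ⁅ x ⁆ (x∈p⇒⁅x⁆⊆p x∈A) (⨁-⁅⁆ w x)

  ∈⟨⟩-trans : ∀ {A B v} → B ⊆⟨ A ⟩ → v ∈⟨ B ⟩ → v ∈⟨ A ⟩
  ∈⟨⟩-trans {A} B⊆⟨A⟩ (T , T⊆B , refl) =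
    ⨁-closed (_∈⟨ A ⟩) 𝟘∈⟨⟩ ⊕-∈⟨⟩ w T (B⊆⟨A⟩ ∘ T⊆B)

  Independent-⊆ : ∀ {A B} → A ⊆ B → Independent B → Independent A
  Independent-⊆ A⊆B indB T T⊆A = indB T (A⊆B ∘ T⊆A)

  private
    ∈∪⁅⁆⇒∈ : ∀ {A : Subset N} {b x} → x ∈ A ∪ ⁅ b ⁆ → x ≢ b → x ∈ A
    ∈∪⁅⁆⇒∈ {A} {b} x∈ x≢b with x∈p∪q⁻ A ⁅ b ⁆ x∈
    ... | inj₁ x∈A   = x∈A
    ... | inj₂ x∈⁅b⁆ = contradiction (x∈⁅y⁆⇒x≡y b x∈⁅b⁆) x≢b

    -⊆- : ∀ {T A : Subset N} {a} → T ⊆ A → T - a ⊆ A - a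
    -⊆- {T} T⊆A x∈ = x∈p∧x≢y⇒x∈p-y (T⊆A (p─q⊆p T _ x∈)) (x∈p-y⇒x≢y T x∈)

  Independent-∪⁅⁆ : ∀ {A b} → Independent A → ¬ w b ∈⟨ A ⟩ → Independent (A ∪ ⁅ b ⁆)
  Independent-∪⁅⁆ {A} {b} indA b∉⟨A⟩ T T⊆ ⨁T≡𝟘 with b ∈? T
  ... | no  b∉T = indA T (λ x∈T → ∈∪⁅⁆⇒∈ (T⊆ x∈T) λ { refl → b∉T x∈T }) ⨁T≡𝟘
  ... | yes b∈T =
    contradiction (∈⟨⟩-intro (T - b) T-b⊆A (sym (⊕≡𝟘⇒≡ (trans (sym (⨁-remove w b∈T)) ⨁T≡𝟘)))) b∉⟨A⟩
    where
    T-b⊆A : T - b ⊆ A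
    T-b⊆A x∈ = ∈∪⁅⁆⇒∈ (T⊆ (p─q⊆p T _ x∈)) (x∈p-y⇒x≢y T x∈)

  exchange-∈⟨⟩ : ∀ {A a b} → w b ∈⟨ A ⟩ → ¬ w b ∈⟨ A - a ⟩ → w a ∈⟨ (A - a) ∪ ⁅ b ⁆ ⟩
  exchange-∈⟨⟩ {A} {a} {b} (T , T⊆A , ⨁T≡wb) b∉⟨A-a⟩ with a ∈? T
  ... | no  a∉T =
    contradiction (∈⟨⟩-intro T (λ x∈T → x∈p∧x≢y⇒x∈p-y (T⊆A x∈T) λ { refl → a∉T x∈T }) ⨁T≡wb) b∉⟨A-a⟩
  ... | yes a∈T = subst (_∈⟨ (A - a) ∪ ⁅ b ⁆ ⟩) wa≡
        (⊕-∈⟨⟩ (∈⇒∈⟨⟩ (x∈p∪q⁺ (inj₂ (x∈⁅x⁆ b)))) (∈⟨⟩-intro (T - a) (p⊆p∪q _ ∘ -⊆- T⊆A) refl))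
    where
    wa≡ : w b ⊕ ⨁ (T - a) w ≡ w a
    wa≡ = begin
      w b ⊕ ⨁ (T - a) w
        ≡⟨ cong (_⊕ ⨁ (T - a) w) (trans (sym ⨁T≡wb) (⨁-remove w a∈T)) ⟩
      w a ⊕ ⨁ (T - a) w ⊕ ⨁ (T - a) w   ≡⟨ ⊕-cancelʳ (w a) _ ⟩
      w a                               ∎
      where open ≡-Reasoning

  ∈⟨⟩⇒∈ : ∀ {A B x} → A ⊆ B → Independent B → x ∈ B → w x ∈⟨ A ⟩ → x ∈ A
  ∈⟨⟩⇒∈ {x = x} A⊆B indB x∈B (T , T⊆A , ⨁T≡wx) = T⊆A (subst (x ∈_) (sym T≡⁅x⁆) (x∈⁅x⁆ x))
    where
    T≡⁅x⁆ : T ≡ ⁅ x ⁆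
    T≡⁅x⁆ = ⊕≡𝟘⇒≡ (indB (T ⊕ ⁅ x ⁆) (p⊕q⊆r (A⊆B ∘ T⊆A) (x∈p⇒⁅x⁆⊆p x∈B))
                      (trans (⨁-⊕ w T ⁅ x ⁆) (trans (cong₂ _⊕_ ⨁T≡wx (⨁-⁅⁆ w x)) (⊕-self (w x)))))

  -- Steinitz exchange, by well-founded induction on ∣ A ─ B ∣: an element of A ─ B is
  -- either dropped or traded for an element of B that it alone helps to span.
  steinitz : ∀ {A B} → Acc _<_ ∣ A ─ B ∣ → Independent A → Independent B → B ⊆⟨ A ⟩ → ∣ B ∣ ≤ ∣ A ∣
  steinitz {A} {B} (acc rec) indA indB B⊆⟨A⟩ with any? (λ a → a ∈? A ×-dec ¬? (a ∈? B))
  ... | no ∄a = p⊆q⇒∣p∣≤∣q∣ (λ x∈B → ∈⟨⟩⇒∈ A⊆B indB x∈B (B⊆⟨A⟩ x∈B))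
    where
    A⊆B : A ⊆ B
    A⊆B {x} x∈A with x ∈? B
    ... | yes x∈B = x∈B
    ... | no  x∉B = contradiction (x , x∈A , x∉B) ∄a
  ... | yes (a , a∈A , a∉B) with unspanned? B (A - a)
  ...   | no ∄b = ≤-trans
    (steinitz (rec (∣r─q∣<∣p─q∣ a∈A a∉B (p⊆p∪q B))) (Independent-⊆ (p─q⊆p A _) indA) indB
              (⊆⟨⟩-unless-unspanned ∄b))
    (<⇒≤ (x∈p⇒∣p-x∣<∣p∣ a∈A))
  ...   | yes (b , b∈B , b∉⟨A-a⟩) =
    ≤-trans (steinitz (rec (∣r─q∣<∣p─q∣ a∈A a∉B A₁⊆)) indA₁ indB B⊆⟨A₁⟩) ∣A₁∣≤∣A∣
    where
    A₁ = (A - a) ∪ ⁅ b ⁆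
    b∉A-a : b ∉ A - a
    b∉A-a b∈ = b∉⟨A-a⟩ (∈⇒∈⟨⟩ b∈)
    indA₁ : Independent A₁
    indA₁ = Independent-∪⁅⁆ (Independent-⊆ (p─q⊆p A _) indA) b∉⟨A-a⟩
    ∣A₁∣≤∣A∣ : ∣ A₁ ∣ ≤ ∣ A ∣
    ∣A₁∣≤∣A∣ = ≤-trans (≤-reflexive (∣p∪⁅x⁆∣≡1+∣p∣ (A - a) b∉A-a)) (x∈p⇒∣p-x∣<∣p∣ a∈A)
    A₁⊆ : A₁ ⊆ (A - a) ∪ B
    A₁⊆ x∈ with x∈p∪q⁻ (A - a) ⁅ b ⁆ x∈
    ... | inj₁ x∈A-a = x∈p∪q⁺ (inj₁ x∈A-a)
    ... | inj₂ x∈⁅b⁆ = x∈p∪q⁺ (inj₂ (x∈p⇒⁅x⁆⊆p b∈B x∈⁅b⁆))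
    A⊆⟨A₁⟩ : A ⊆⟨ A₁ ⟩
    A⊆⟨A₁⟩ {x} x∈A with x ≟ᶠ a
    ... | yes refl = exchange-∈⟨⟩ (B⊆⟨A⟩ b∈B) b∉⟨A-a⟩
    ... | no  x≢a  = ∈⇒∈⟨⟩ (x∈p∪q⁺ (inj₁ (x∈p∧x≢y⇒x∈p-y x∈A x≢a)))
    B⊆⟨A₁⟩ : B ⊆⟨ A₁ ⟩
    B⊆⟨A₁⟩ x∈B = ∈⟨⟩-trans A⊆⟨A₁⟩ (B⊆⟨A⟩ x∈B)

  exchange : ∀ {A B} → Independent A → Independent B → ∣ A ∣ < ∣ B ∣ →
             ∃ λ x → x ∈ B × x ∉ A × Independent (A ∪ ⁅ x ⁆)
  exchange {A} {B} indA indB ∣A∣<∣B∣ with unspanned? B A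
  ... | yes (b , b∈B , b∉⟨A⟩) = b , b∈B , (λ b∈A → b∉⟨A⟩ (∈⇒∈⟨⟩ b∈A)) , Independent-∪⁅⁆ indA b∉⟨A⟩
  ... | no ∄b = contradiction (steinitz (<-wellFounded _) indA indB (⊆⟨⟩-unless-unspanned ∄b))
                              (<⇒≱ ∣A∣<∣B∣)

truncatedBinaryMatroid : ∀ {N D} → (Fin N → Vec Bool D) → ℕ → Matroid N
truncatedBinaryMatroid {N} w r = record
  { Indep        = λ A → Independent A × ∣ A ∣ ≤ r
  ; indep-empty  = (λ T T⊆⊥ _ → ⊆-antisym T⊆⊥ (⊆-min T)) , ≤-trans (≤-reflexive (∣⊥∣≡0 N)) z≤n
  ; indep-subset = λ A⊆B (indB , ∣B∣≤r) → Independent-⊆ A⊆B indB , ≤-trans (p⊆q⇒∣p∣≤∣q∣ A⊆B) ∣B∣≤r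
  ; indep-exch   = exch
  }
  where
  open LinearAlgebra w
  exch : ∀ {A B} → Independent A × ∣ A ∣ ≤ r → Independent B × ∣ B ∣ ≤ r → ∣ A ∣ < ∣ B ∣ →
         ∃ λ x → x ∈ B × x ∉ A × Independent (A ∪ ⁅ x ⁆) × ∣ A ∪ ⁅ x ⁆ ∣ ≤ r
  exch {A} (indA , _) (indB , ∣B∣≤r) ∣A∣<∣B∣ with exchange indA indB ∣A∣<∣B∣
  ... | x , x∈B , x∉A , indAx =
    x , x∈B , x∉A , indAx , ≤-trans (≤-reflexive (∣p∪⁅x⁆∣≡1+∣p∣ A x∉A)) (≤-trans ∣A∣<∣B∣ ∣B∣≤r)

image : ∀ {K N} → (Fin K → Fin N) → Subset N
image {zero}  g = ⊥
image {suc K} g = image (g ∘ suc) ∪ ⁅ g zero ⁆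

module _ {N : ℕ} where

  ∈-image⁻ : ∀ {K} (g : Fin K → Fin N) {x} → x ∈ image g → ∃ λ i → x ≡ g i
  ∈-image⁻ {zero}  g x∈ = contradiction x∈ ∉⊥
  ∈-image⁻ {suc K} g x∈ with x∈p∪q⁻ (image (g ∘ suc)) ⁅ g zero ⁆ x∈
  ... | inj₁ x∈′ = let i , x≡ = ∈-image⁻ (g ∘ suc) x∈′ in suc i , x≡
  ... | inj₂ x∈⁅⁆ = zero , x∈⁅y⁆⇒x≡y (g zero) x∈⁅⁆

  ∈-image⁺ : ∀ {K} (g : Fin K → Fin N) i → g i ∈ image g
  ∈-image⁺ g zero    = x∈p∪q⁺ (inj₂ (x∈⁅x⁆ (g zero)))
  ∈-image⁺ g (suc i) = x∈p∪q⁺ (inj₁ (∈-image⁺ (g ∘ suc) i))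

  ∣image∣ : ∀ {K} (g : Fin K → Fin N) → Injective _≡_ _≡_ g → ∣ image g ∣ ≡ K
  ∣image∣ {zero}  g _     = ∣⊥∣≡0 N
  ∣image∣ {suc K} g g-inj =
    trans (∣p∪⁅x⁆∣≡1+∣p∣ (image (g ∘ suc)) g0∉)
          (cong suc (∣image∣ (g ∘ suc) (suc-injective ∘ g-inj)))
    where
    g0∉ : g zero ∉ image (g ∘ suc)
    g0∉ g0∈ with ∈-image⁻ (g ∘ suc) g0∈
    ... | i , g0≡ = 0≢1+n (g-inj g0≡)

quad : ∀ {N} → Fin N → Fin N → Fin N → Fin N → Subset N
quad a b c e = ⁅ a ⁆ ⊕ (⁅ b ⁆ ⊕ (⁅ c ⁆ ⊕ ⁅ e ⁆))

module _ {N : ℕ} {a b c e : Fin N} where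

  private
    ∈⁅y⁆⊕p⁻ : ∀ {x y : Fin N} {p} → x ∈ ⁅ y ⁆ ⊕ p → x ≡ y ⊎ x ∈ p
    ∈⁅y⁆⊕p⁻ {y = y} {p} x∈ with x∈p⊕q⁻ ⁅ y ⁆ p x∈
    ... | inj₁ x∈⁅y⁆ = inj₁ (x∈⁅y⁆⇒x≡y y x∈⁅y⁆)
    ... | inj₂ x∈p   = inj₂ x∈p

    ∈-triple⁻ : ∀ {x} → x ∈ ⁅ b ⁆ ⊕ (⁅ c ⁆ ⊕ ⁅ e ⁆) → x ≡ b ⊎ x ≡ c ⊎ x ≡ e
    ∈-triple⁻ x∈ with ∈⁅y⁆⊕p⁻ x∈
    ... | inj₁ x≡b = inj₁ x≡b
    ... | inj₂ x∈′ with ∈⁅y⁆⊕p⁻ x∈′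
    ...   | inj₁ x≡c   = inj₂ (inj₁ x≡c)
    ...   | inj₂ x∈⁅e⁆ = inj₂ (inj₂ (x∈⁅y⁆⇒x≡y e x∈⁅e⁆))

  ∈-quad⁻ : ∀ {x} → x ∈ quad a b c e → x ≡ a ⊎ x ≡ b ⊎ x ≡ c ⊎ x ≡ e
  ∈-quad⁻ x∈ with ∈⁅y⁆⊕p⁻ x∈
  ... | inj₁ x≡a = inj₁ x≡a
  ... | inj₂ x∈′ = inj₂ (∈-triple⁻ x∈′)

  ∈-quad⁺ : a ≢ b → a ≢ c → a ≢ e → a ∈ quad a b c e
  ∈-quad⁺ a≢b a≢c a≢e = x∈p⊕q⁺ (x∈⁅x⁆ a) λ a∈ → case ∈-triple⁻ a∈ of λ where
    (inj₁ a≡b)        → a≢b a≡b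
    (inj₂ (inj₁ a≡c)) → a≢c a≡c
    (inj₂ (inj₂ a≡e)) → a≢e a≡e

  ⨁-quad : ∀ {D} (w : Fin N → Vec Bool D) → ⨁ (quad a b c e) w ≡ w a ⊕ (w b ⊕ (w c ⊕ w e))
  ⨁-quad w = begin
    ⨁ (quad a b c e) w                   ≡⟨ ⨁-⁅⁆⊕ a _ ⟩
    w a ⊕ ⨁ (⁅ b ⁆ ⊕ (⁅ c ⁆ ⊕ ⁅ e ⁆)) w  ≡⟨ cong (w a ⊕_) (⨁-⁅⁆⊕ b _) ⟩
    w a ⊕ (w b ⊕ ⨁ (⁅ c ⁆ ⊕ ⁅ e ⁆) w)    ≡⟨ cong (λ t → w a ⊕ (w b ⊕ t)) (⨁-⁅⁆⊕ c ⁅ e ⁆) ⟩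
    w a ⊕ (w b ⊕ (w c ⊕ ⨁ ⁅ e ⁆ w))      ≡⟨ cong (λ t → w a ⊕ (w b ⊕ (w c ⊕ t))) (⨁-⁅⁆ w e) ⟩
    w a ⊕ (w b ⊕ (w c ⊕ w e))            ∎
    where
    open ≡-Reasoning
    ⨁-⁅⁆⊕ : ∀ x T → ⨁ (⁅ x ⁆ ⊕ T) w ≡ w x ⊕ ⨁ T w
    ⨁-⁅⁆⊕ x T = trans (⨁-⊕ w ⁅ x ⁆ T) (cong (_⊕ ⨁ T w) (⨁-⁅⁆ w x))

quad-PartIndep : ∀ {N m} (f : Fin N → Fin m) {a b c e} →
  f a ≢ f b → f a ≢ f c → f a ≢ f e → f b ≢ f c → f b ≢ f e → f c ≢ f e → PartIndep f (quad a b c e)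
quad-PartIndep f ab ac ae bc be ce x y x∈ y∈ fx≡fy with ∈-quad⁻ x∈ | ∈-quad⁻ y∈
... | inj₁ refl                 | inj₁ refl                 = refl
... | inj₁ refl                 | inj₂ (inj₁ refl)          = ⊥-elim (ab fx≡fy)
... | inj₁ refl                 | inj₂ (inj₂ (inj₁ refl))   = ⊥-elim (ac fx≡fy)
... | inj₁ refl                 | inj₂ (inj₂ (inj₂ refl))   = ⊥-elim (ae fx≡fy)
... | inj₂ (inj₁ refl)          | inj₁ refl                 = ⊥-elim (ab (sym fx≡fy))
... | inj₂ (inj₁ refl)          | inj₂ (inj₁ refl)          = refl
... | inj₂ (inj₁ refl)          | inj₂ (inj₂ (inj₁ refl))   = ⊥-elim (bc fx≡fy)
... | inj₂ (inj₁ refl)          | inj₂ (inj₂ (inj₂ refl))   = ⊥-elim (be fx≡fy)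
... | inj₂ (inj₂ (inj₁ refl))   | inj₁ refl                 = ⊥-elim (ac (sym fx≡fy))
... | inj₂ (inj₂ (inj₁ refl))   | inj₂ (inj₁ refl)          = ⊥-elim (bc (sym fx≡fy))
... | inj₂ (inj₂ (inj₁ refl))   | inj₂ (inj₂ (inj₁ refl))   = refl
... | inj₂ (inj₂ (inj₁ refl))   | inj₂ (inj₂ (inj₂ refl))   = ⊥-elim (ce fx≡fy)
... | inj₂ (inj₂ (inj₂ refl))   | inj₁ refl                 = ⊥-elim (ae (sym fx≡fy))
... | inj₂ (inj₂ (inj₂ refl))   | inj₂ (inj₁ refl)          = ⊥-elim (be (sym fx≡fy))
... | inj₂ (inj₂ (inj₂ refl))   | inj₂ (inj₂ (inj₁ refl))   = ⊥-elim (ce (sym fx≡fy))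
... | inj₂ (inj₂ (inj₂ refl))   | inj₂ (inj₂ (inj₂ refl))   = refl

affine : ∀ {N D} → (Fin N → Vec Bool D) → Fin N → Vec Bool (suc D)
affine v x = true ∷ v x

module _ {D : ℕ} (c : Fin D) (b : Bool) where

  -- On affine points (1, v) this is v[c] + b, a linear functional.
  functional : Vec Bool (suc D) → Bool
  functional u = lookup u (suc c) xor (b ∧ lookup u zero)

  functional-𝟘 : functional 𝟘 ≡ false
  functional-𝟘 = cong₂ _xor_ (lookup-replicate c false) (∧-zeroʳ b)

  functional-⊕ : ∀ u u′ → functional (u ⊕ u′) ≡ functional u xor functional u′
  functional-⊕ u u′ = begin
    lookup (u ⊕ u′) (suc c) xor (b ∧ lookup (u ⊕ u′) zero)
      ≡⟨ cong₂ (λ s t → s xor (b ∧ t)) (lookup-⊕ u u′ (suc c)) (lookup-⊕ u u′ zero) ⟩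
    (s xor s′) xor (b ∧ (t xor t′))
      ≡⟨ cong ((s xor s′) xor_) (∧-distribˡ-xor b t t′) ⟩
    (s xor s′) xor ((b ∧ t) xor (b ∧ t′))
      ≡⟨ xor-interchange s s′ (b ∧ t) (b ∧ t′) ⟩
    functional u xor functional u′ ∎
    where
    open ≡-Reasoning
    s = lookup u (suc c)
    s′ = lookup u′ (suc c)
    t = lookup u zero
    t′ = lookup u′ zero

  functional-affine : ∀ {v : Vec Bool D} {a} → lookup v c ≡ b xor a → functional (true ∷ v) ≡ a
  functional-affine {v} {a} v[c]≡ = begin
    lookup v c xor (b ∧ true) ≡⟨ cong₂ _xor_ v[c]≡ (∧-identityʳ b) ⟩
    (b xor a) xor b           ≡⟨ cong (_xor b) (xor-comm b a) ⟩
    (a xor b) xor b           ≡⟨ xor-assoc a b b ⟩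
    a xor (b xor b)           ≡⟨ cong (a xor_) (xor-same b) ⟩
    a xor false               ≡⟨ xor-identityʳ a ⟩
    a                         ∎
    where open ≡-Reasoning

module _ {N D : ℕ} (v : Fin N → Vec Bool D) where
  open LinearAlgebra (affine v)

  -- functional c b vanishes on every point except g i, so g i cannot occur in a vanishing sum.
  separated⇒Independent : ∀ {K} (g : Fin K → Fin N) →
    (∀ i → ∃ λ c → ∃ λ b → ∀ j → lookup (v (g j)) c ≡ b xor does (i ≟ᶠ j)) →
    Independent (image g)
  separated⇒Independent g sep T T⊆ ⨁T≡𝟘 = Empty-unique λ (x , x∈T) → excluded x∈T
    where
    excluded : ∀ {x} → x ∉ T
    excluded {x} x∈T with ∈-image⁻ g (T⊆ x∈T)
    ... | i , refl with sep i
    ... | c , b , sepᵢ =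
      contradiction (trans (sym (functional-𝟘 c b)) (trans (cong φ (sym ⨁T≡𝟘)) φ⨁T)) λ ()
      where
      φ = functional c b
      φ-point : ∀ j → φ (affine v (g j)) ≡ does (i ≟ᶠ j)
      φ-point j = functional-affine c b {v (g j)} (sepᵢ j)
      φ-rest : φ (⨁ (T - g i) (affine v)) ≡ false
      φ-rest = ⨁-closed (λ u → φ u ≡ false) (functional-𝟘 c b)
                 (λ {u} {u′} φu≡ φu′≡ → trans (functional-⊕ c b u u′) (cong₂ _xor_ φu≡ φu′≡))
                 (affine v) (T - g i) φ-other
        where
        φ-other : ∀ {y} → y ∈ T - g i → φ (affine v y) ≡ false
        φ-other y∈ with ∈-image⁻ g (T⊆ (p─q⊆p T _ y∈))
        ... | j , refl = trans (φ-point j) (dec-false (i ≟ᶠ j) λ { refl → x∈p-y⇒x≢y T y∈ refl })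
      φ⨁T : φ (⨁ T (affine v)) ≡ true
      φ⨁T = begin
        φ (⨁ T (affine v))                  ≡⟨ cong φ (⨁-remove (affine v) x∈T) ⟩
        φ (affine v (g i) ⊕ R)              ≡⟨ functional-⊕ c b (affine v (g i)) R ⟩
        φ (affine v (g i)) xor φ R          ≡⟨ cong₂ _xor_ (φ-point i) φ-rest ⟩
        does (i ≟ᶠ i) xor false             ≡⟨ cong (_xor false) (dec-true (i ≟ᶠ i) refl) ⟩
        true                                ∎
        where
        open ≡-Reasoning
        R = ⨁ (T - g i) (affine v)

𝟙[_] : ∀ {P : Set} → Dec P → ℕ
𝟙[ P? ] = if does P? then 1 else 0

sum-mono-≤ : ∀ {n} {f g : Fin n → ℕ} → (∀ i → f i ≤ g i) → sum f ≤ sum g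
sum-mono-≤ {zero}  f≤g = z≤n
sum-mono-≤ {suc n} f≤g = +-mono-≤ (f≤g zero) (sum-mono-≤ (f≤g ∘ suc))

∑-const : ∀ n c → ∑[ i < n ] c ≡ n * c
∑-const zero    c = refl
∑-const (suc n) c = cong (c +_) (∑-const n c)

f≤∑f : ∀ {n} (f : Fin n → ℕ) i → f i ≤ sum f
f≤∑f f zero    = m≤m+n (f zero) _
f≤∑f f (suc i) = ≤-trans (f≤∑f (f ∘ suc) i) (m≤n+m _ (f zero))

∑-involution : ∀ {n} (σ : Fin n → Fin n) → (∀ x → σ (σ x) ≡ x) → (f : Fin n → ℕ) →
               ∑[ x < n ] f (σ x) ≡ sum f
∑-involution σ σσ f = sym (sum-permute f (permutation σ σ σσ σσ))

𝟙-yes : ∀ {P : Set} (P? : Dec P) → P → 𝟙[ P? ] ≡ 1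
𝟙-yes P? p = cong (λ b → if b then 1 else 0) (dec-true P? p)

𝟙-no : ∀ {P : Set} (P? : Dec P) → ¬ P → 𝟙[ P? ] ≡ 0
𝟙-no P? ¬p = cong (λ b → if b then 1 else 0) (dec-false P? ¬p)

unique⇒∑𝟙≤1 : ∀ {n} {P : Pred (Fin n) 0ℓ} (P? : Decidable P) → (∀ {x y} → P x → P y → x ≡ y) →
       ∑[ x < n ] 𝟙[ P? x ] ≤ 1
unique⇒∑𝟙≤1 {zero}  P? unique = z≤n
unique⇒∑𝟙≤1 {suc n} P? unique with P? zero
... | yes P0 = s≤s (≤-trans (sum-mono-≤ λ x → ≤-reflexive (𝟙-no (P? (suc x)) (0≢1+n ∘ unique P0)))
                            (≤-reflexive (trans (∑-const n 0) (*-zeroʳ n))))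
... | no  _  = unique⇒∑𝟙≤1 (P? ∘ suc) (λ Px Py → suc-injective (unique Px Py))

injective⇒∑𝟙≤ : ∀ {n K} {P : Pred (Fin n) 0ℓ} (P? : Decidable P) (g : Fin n → Fin K) →
      (∀ {x y} → P x → P y → g x ≡ g y → x ≡ y) → ∑[ x < n ] 𝟙[ P? x ] ≤ K
injective⇒∑𝟙≤ {n} {K} {P} P? g g-inj = begin
  ∑[ x < n ] 𝟙[ P? x ]                                ≤⟨ sum-mono-≤ spread ⟩
  ∑[ x < n ] ∑[ i < K ] 𝟙[ P? x ×-dec g x ≟ᶠ i ]     ≡⟨ ∑-comm (λ x i → 𝟙[ P? x ×-dec g x ≟ᶠ i ]) ⟩
  ∑[ i < K ] ∑[ x < n ] 𝟙[ P? x ×-dec g x ≟ᶠ i ]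
    ≤⟨ sum-mono-≤ (λ i → unique⇒∑𝟙≤1 (λ x → P? x ×-dec g x ≟ᶠ i) fibre-unique) ⟩
  ∑[ i < K ] 1                                        ≡⟨ trans (∑-const K 1) (*-identityʳ K) ⟩
  K                                                   ∎
  where
  open ≤-Reasoning
  spread : ∀ x → 𝟙[ P? x ] ≤ ∑[ i < K ] 𝟙[ P? x ×-dec g x ≟ᶠ i ]
  spread x = by-cases (P? x)
    where
    by-cases : Dec (P x) → 𝟙[ P? x ] ≤ ∑[ i < K ] 𝟙[ P? x ×-dec g x ≟ᶠ i ]
    by-cases (no ¬Px) = ≤-trans (≤-reflexive (𝟙-no (P? x) ¬Px)) z≤n
    by-cases (yes Px) = begin
      𝟙[ P? x ]                            ≡⟨ 𝟙-yes (P? x) Px ⟩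
      1                                    ≡⟨ 𝟙-yes (P? x ×-dec g x ≟ᶠ g x) (Px , refl) ⟨
      𝟙[ P? x ×-dec g x ≟ᶠ g x ]           ≤⟨ f≤∑f (λ i → 𝟙[ P? x ×-dec g x ≟ᶠ i ]) (g x) ⟩
      ∑[ i < K ] 𝟙[ P? x ×-dec g x ≟ᶠ i ]  ∎
  fibre-unique : ∀ {i x y} → P x × g x ≡ i → P y × g y ≡ i → x ≡ y
  fibre-unique (Px , refl) (Py , gy≡) = g-inj Px Py (sym gy≡)

m*m≤m*n⇒m≤n : ∀ m n → m * m ≤ m * n → m ≤ n
m*m≤m*n⇒m≤n zero    n _  = z≤n
m*m≤m*n⇒m≤n (suc m) n le = *-cancelˡ-≤ (suc m) le

pairSum : ∀ {n} → (Fin n → Fin n → ℕ) → Fin n → Fin n → Fin n → Fin n → ℕ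
pairSum C a b c e = C a b + (C a c + (C a e + (C b c + (C b e + C c e))))

module DoubleSum (n : ℕ) where

  ∑∑ : (Fin n → Fin n → ℕ) → ℕ
  ∑∑ g = ∑[ y < n ] ∑[ z < n ] g y z

  ∑∑-rows : ∀ {j} g → (∀ y → ∑[ z < n ] g y z ≤ j) → ∑∑ g ≤ n * j
  ∑∑-rows {j} g rows = ≤-trans (sum-mono-≤ rows) (≤-reflexive (∑-const n j))

  ∑∑-columns : ∀ {j} g → (∀ z → ∑[ y < n ] g y z ≤ j) → ∑∑ g ≤ n * j
  ∑∑-columns g columns = ≤-trans (≤-reflexive (∑-comm g)) (∑∑-rows (λ z y → g y z) columns)

  ∑∑-+ : ∀ {g h a b} → ∑∑ g ≤ a → ∑∑ h ≤ b → ∑∑ (λ y z → g y z + h y z) ≤ a + b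
  ∑∑-+ {g} {h} g≤a h≤b = ≤-trans
    (≤-reflexive (trans (sum-cong-≗ (λ y → ∑-distrib-+ (g y) (h y)))
                        (∑-distrib-+ (λ y → ∑[ z < n ] g y z) (λ y → ∑[ z < n ] h y z))))
    (+-mono-≤ g≤a h≤b)

  n*n≤∑∑ : ∀ g → (∀ y z → 1 ≤ g y z) → n * n ≤ ∑∑ g
  n*n≤∑∑ g 1≤g = begin
    n * n           ≡⟨ cong (n *_) (trans (∑-const n 1) (*-identityʳ n)) ⟨
    n * ∑[ z < n ] 1 ≡⟨ ∑-const n _ ⟨
    ∑∑ (λ _ _ → 1)  ≤⟨ sum-mono-≤ (λ y → sum-mono-≤ (1≤g y)) ⟩
    ∑∑ g            ∎
    where open ≤-Reasoning

-- Summed over z, or over y for C o y and C z (y ∙ z), each of the six terms is a row sum of C,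
-- possibly reindexed by the involution y ∙_ or z ∙_, and hence at most j.
quadruple-counting :
  ∀ {n j} (C : Fin n → Fin n → ℕ) → (∀ a → ∑[ b < n ] C a b ≤ j) →
  (_∙_ : Fin n → Fin n → Fin n) → (∀ y z → y ∙ z ≡ z ∙ y) → (∀ y z → y ∙ (y ∙ z) ≡ z) →
  (o : Fin n) → (∀ y z → 1 ≤ pairSum C o y z (y ∙ z)) → n ≤ 6 * j
quadruple-counting {n} {j} C C-rows _∙_ ∙-comm ∙-cancelˡ o hit = m*m≤m*n⇒m≤n n (6 * j) (begin
  n * n                                      ≤⟨ n*n≤∑∑ _ hit ⟩
  ∑∑ (λ y z → pairSum C o y z (y ∙ z))       ≤⟨ all-pairs ⟩
  nj + (nj + (nj + (nj + (nj + nj))))        ≡⟨ six-times n j ⟩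
  n * (6 * j)                                ∎)
  where
  open ≤-Reasoning
  open DoubleSum n
  nj = n * j

  shifted-row : ∀ a y → ∑[ z < n ] C a (y ∙ z) ≤ j
  shifted-row a y = ≤-trans (≤-reflexive (∑-involution (y ∙_) (∙-cancelˡ y) (C a))) (C-rows a)

  all-pairs : ∑∑ (λ y z → pairSum C o y z (y ∙ z)) ≤ nj + (nj + (nj + (nj + (nj + nj))))
  all-pairs =
    ∑∑-+ (∑∑-columns _ (λ _ → C-rows o))
    (∑∑-+ (∑∑-rows _ (λ _ → C-rows o))
    (∑∑-+ (∑∑-rows _ (shifted-row o))
    (∑∑-+ (∑∑-rows _ C-rows)
    (∑∑-+ (∑∑-rows _ (λ y → shifted-row y y))
          (∑∑-columns _ λ z → ≤-trans (≤-reflexive (sum-cong-≗ λ y → cong (C z) (∙-comm y z)))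
                                      (shifted-row z z))))))

  six-times : ∀ n j → n * j + (n * j + (n * j + (n * j + (n * j + n * j)))) ≡ n * (6 * j)
  six-times = solve-∀

∷↔ : ∀ {A : Set} {m} → (A × Vec A m) ↔ Vec A (suc m)
∷↔ = mk↔ₛ′ (λ (x , xs) → x ∷ xs) (λ { (x ∷ xs) → x , xs })
           (λ { (x ∷ xs) → refl }) (λ { (x , xs) → refl })

bits↔ : ∀ m → Fin (2 ^ m) ↔ Vec Bool m
bits↔ zero    = mk↔ₛ′ (λ _ → []) (λ _ → zero) (λ { [] → refl }) (λ { zero → refl })
bits↔ (suc m) = ∷↔ ↔-∘ ((2↔Bool ×-↔ bits↔ m) ↔-∘ *↔×)

module Bits (m : ℕ) where

  toBits : Fin (2 ^ m) → Vec Bool m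
  toBits = Inverse.to (bits↔ m)

  fromBits : Vec Bool m → Fin (2 ^ m)
  fromBits = Inverse.from (bits↔ m)

  toBits-fromBits : ∀ u → toBits (fromBits u) ≡ u
  toBits-fromBits = Inverse.strictlyInverseˡ (bits↔ m)

  fromBits-toBits : ∀ x → fromBits (toBits x) ≡ x
  fromBits-toBits = Inverse.strictlyInverseʳ (bits↔ m)

  toBits-injective : ∀ {x y} → toBits x ≡ toBits y → x ≡ y
  toBits-injective {x} {y} eq =
    trans (sym (fromBits-toBits x)) (trans (cong fromBits eq) (fromBits-toBits y))

  infixl 6 _∙_

  _∙_ : Fin (2 ^ m) → Fin (2 ^ m) → Fin (2 ^ m)
  x ∙ y = fromBits (toBits x ⊕ toBits y)

  toBits-∙ : ∀ x y → toBits (x ∙ y) ≡ toBits x ⊕ toBits y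
  toBits-∙ x y = toBits-fromBits _

  ∙-comm : ∀ x y → x ∙ y ≡ y ∙ x
  ∙-comm x y = cong fromBits (⊕-comm (toBits x) (toBits y))

  ∙-cancelˡ : ∀ x y → x ∙ (x ∙ y) ≡ y
  ∙-cancelˡ x y = toBits-injective (trans (toBits-∙ x (x ∙ y))
                    (trans (cong (toBits x ⊕_) (toBits-∙ x y)) (⊕-cancelˡ (toBits x) (toBits y))))

  origin : Fin (2 ^ m)
  origin = fromBits 𝟘

  affine-square : ∀ x y →
    affine toBits origin ⊕ (affine toBits x ⊕ (affine toBits y ⊕ affine toBits (x ∙ y))) ≡ 𝟘
  affine-square x y = cong (false ∷_) (begin
    toBits origin ⊕ (u ⊕ (v ⊕ toBits (x ∙ y)))
      ≡⟨ cong₂ (λ s t → s ⊕ (u ⊕ (v ⊕ t))) (toBits-fromBits 𝟘) (toBits-∙ x y) ⟩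
    𝟘 ⊕ (u ⊕ (v ⊕ (u ⊕ v)))                                  ≡⟨ ⊕-identityˡ _ ⟩
    u ⊕ (v ⊕ (u ⊕ v))                                        ≡⟨ cong (u ⊕_) (⊕-swapˡ v u v) ⟩
    u ⊕ (u ⊕ (v ⊕ v))                                        ≡⟨ ⊕-cancelˡ u (v ⊕ v) ⟩
    v ⊕ v                                                    ≡⟨ ⊕-self v ⟩
    𝟘                                                        ∎)
    where
    open ≡-Reasoning
    u = toBits x
    v = toBits y

module Construction (q d : ℕ) (2^q≤d : 2 ^ q ≤ d) where

  n : ℕ
  n = 2 ^ (q + d)

  open Bits (q + d)
  open Bits q using ()
    renaming (toBits to toBitsʸ; fromBits to fromBitsʸ; toBits-fromBits to toBitsʸ-fromBitsʸ;
              toBits-injective to toBitsʸ-injective)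
  open Bits d using ()
    renaming (toBits to toBitsʰ; fromBits to fromBitsʰ; toBits-fromBits to toBitsʰ-fromBitsʰ)

  point : Vec Bool q → Vec Bool d → Fin n
  point y z = fromBits (y ++ z)

  lookup-point : ∀ y z i → lookup (toBits (point y z)) (q ↑ʳ i) ≡ lookup z i
  lookup-point y z i =
    trans (cong (λ u → lookup u (q ↑ʳ i)) (toBits-fromBits (y ++ z))) (lookup-++ʳ y z i)

  M : Matroid n
  M = truncatedBinaryMatroid (affine toBits) d

  open LinearAlgebra (affine toBits)

  unit : Fin d → Fin n
  unit i = point 𝟘 ⁅ i ⁆

  unit-injective : Injective _≡_ _≡_ unit
  unit-injective {i} {j} eq = x∈⁅y⁆⇒x≡y j (subst (i ∈_) ⁅i⁆≡⁅j⁆ (x∈⁅x⁆ i))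
    where
    ⁅i⁆≡⁅j⁆ : ⁅ i ⁆ ≡ ⁅ j ⁆
    ⁅i⁆≡⁅j⁆ = ++-injectiveʳ 𝟘 𝟘
      (trans (sym (toBits-fromBits _)) (trans (cong toBits eq) (toBits-fromBits _)))

  hasRank : HasRank M d
  hasRank = (image unit , (units-independent , ≤-reflexive ∣units∣) , ∣units∣) , λ _ → proj₂
    where
    ∣units∣ : ∣ image unit ∣ ≡ d
    ∣units∣ = ∣image∣ unit unit-injective
    units-independent : Independent (image unit)
    units-independent = separated⇒Independent toBits unit
      λ i → q ↑ʳ i , false , λ j → trans (lookup-point 𝟘 ⁅ j ⁆ i) (lookup-⁅⁆ i j)

  slot : Fin (2 ^ q) → Fin d
  slot i = inject≤ i 2^q≤d

  cell : Vec Bool d → Fin (2 ^ q) → Fin n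
  cell h i = point (toBitsʸ i) (h ⊕ ⁅ slot i ⁆)

  cell-injective : ∀ h → Injective _≡_ _≡_ (cell h)
  cell-injective h eq = toBitsʸ-injective (++-injectiveˡ (toBitsʸ _) (toBitsʸ _)
    (trans (sym (toBits-fromBits _)) (trans (cong toBits eq) (toBits-fromBits _))))

  lookup-cell : ∀ h i j →
    lookup (toBits (cell h j)) (q ↑ʳ slot i) ≡ lookup h (slot i) xor does (i ≟ᶠ j)
  lookup-cell h i j = begin
    lookup (toBits (cell h j)) (q ↑ʳ slot i)          ≡⟨ lookup-point (toBitsʸ j) _ (slot i) ⟩
    lookup (h ⊕ ⁅ slot j ⁆) (slot i)                  ≡⟨ lookup-⊕ h ⁅ slot j ⁆ (slot i) ⟩
    lookup h (slot i) xor lookup ⁅ slot j ⁆ (slot i)  ≡⟨ cong (hᵢ xor_) (lookup-⁅⁆ _ (slot j)) ⟩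
    lookup h (slot i) xor does (slot i ≟ᶠ slot j)     ≡⟨ cong (hᵢ xor_) slot-does ⟩
    lookup h (slot i) xor does (i ≟ᶠ j)               ∎
    where
    open ≡-Reasoning
    hᵢ = lookup h (slot i)
    slot-does : does (slot i ≟ᶠ slot j) ≡ does (i ≟ᶠ j)
    slot-does =
      does-≡ (slot i ≟ᶠ slot j) (map′ (cong slot) (inject≤-injective 2^q≤d 2^q≤d i j) (i ≟ᶠ j))

  cells-independent : ∀ h → Independent (image (cell h))
  cells-independent h =
    separated⇒Independent toBits (cell h) λ i → q ↑ʳ slot i , lookup h (slot i) , lookup-cell h i

  cover : Coverable M (2 ^ d)
  cover = image ∘ cell ∘ toBitsʰ ,
          (λ k → cells-independent (toBitsʰ k) , ∣cells∣≤d (toBitsʰ k)) ,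
          covered
    where
    ∣cells∣≤d : ∀ h → ∣ image (cell h) ∣ ≤ d
    ∣cells∣≤d h = ≤-trans (≤-reflexive (∣image∣ (cell h) (cell-injective h))) 2^q≤d
    covered : ∀ x → ∃ λ k → x ∈ image (cell (toBitsʰ k))
    covered x = fromBitsʰ h , subst (λ h′ → x ∈ image (cell h′)) (sym (toBitsʰ-fromBitsʰ h))
                                   (subst (_∈ image (cell h)) cell≡x (∈-image⁺ (cell h) i))
      where
      y = take q (toBits x)
      z = drop q (toBits x)
      i = fromBitsʸ y
      h = z ⊕ ⁅ slot i ⁆
      cell≡x : cell h i ≡ x
      cell≡x = begin
        fromBits (toBitsʸ i ++ (z ⊕ ⁅ slot i ⁆ ⊕ ⁅ slot i ⁆))
          ≡⟨ cong₂ (λ s t → fromBits (s ++ t)) (toBitsʸ-fromBitsʸ y) (⊕-cancelʳ z ⁅ slot i ⁆) ⟩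
        fromBits (y ++ z)                                    ≡⟨ cong fromBits (take++drop≡id q _) ⟩
        fromBits (toBits x)                                  ≡⟨ fromBits-toBits x ⟩
        x                                                    ∎
        where open ≡-Reasoning

  module _ (P : Matroid n) (P-partition : IsPartitionMatroid P) (P≤M : IsReductionOf P M) where

    private
      f : Fin n → Fin (proj₁ P-partition)
      f = proj₁ (proj₂ P-partition)

      Indep⇒PartIndep : ∀ S → Indep P S → PartIndep f S
      Indep⇒PartIndep S = proj₁ (proj₂ (proj₂ P-partition) S)

      PartIndep⇒Indep : ∀ S → PartIndep f S → Indep P S
      PartIndep⇒Indep S = proj₂ (proj₂ (proj₂ P-partition) S)

    samePart : Fin n → Fin n → ℕ
    samePart a b = 𝟙[ f a ≟ᶠ f b ]

    square-collides : ∀ x y → 1 ≤ pairSum samePart origin x y (x ∙ y)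
    square-collides x y
      with f origin ≟ᶠ f x | f origin ≟ᶠ f y | f origin ≟ᶠ f (x ∙ y)
         | f x ≟ᶠ f y | f x ≟ᶠ f (x ∙ y) | f y ≟ᶠ f (x ∙ y)
    ... | yes _ | _     | _     | _     | _     | _     = s≤s z≤n
    ... | no _  | yes _ | _     | _     | _     | _     = s≤s z≤n
    ... | no _  | no _  | yes _ | _     | _     | _     = s≤s z≤n
    ... | no _  | no _  | no _  | yes _ | _     | _     = s≤s z≤n
    ... | no _  | no _  | no _  | no _  | yes _ | _     = s≤s z≤n
    ... | no _  | no _  | no _  | no _  | no _  | yes _ = s≤s z≤n
    ... | no ox | no oy | no oe | no xy | no xe | no ye =
      ⊥-elim (∉⊥ (subst (origin ∈_) T≡⊥ origin∈T))
      where
      T = quad origin x y (x ∙ y)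
      T-independent : Independent T
      T-independent = proj₁ (P≤M T (PartIndep⇒Indep T (quad-PartIndep f ox oy oe xy xe ye)))
      T≡⊥ : T ≡ ⊥
      T≡⊥ = T-independent T (λ t∈ → t∈) (trans (⨁-quad (affine toBits)) (affine-square x y))
      origin∈T : origin ∈ T
      origin∈T = ∈-quad⁺ (ox ∘ cong f) (oy ∘ cong f) (oe ∘ cong f)

    part-size≤ : ∀ {j} → Coverable P j → ∀ a → ∑[ b < n ] samePart a b ≤ j
    part-size≤ (F , F-indep , F-covers) a =
      injective⇒∑𝟙≤ (λ b → f a ≟ᶠ f b) (proj₁ ∘ F-covers) one-per-block
      where
      one-per-block : ∀ {b b′} → f a ≡ f b → f a ≡ f b′ →
                      proj₁ (F-covers b) ≡ proj₁ (F-covers b′) → b ≡ b′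
      one-per-block {b} {b′} fa≡fb fa≡fb′ same-block =
        Indep⇒PartIndep (F _) (F-indep _) b b′ (proj₂ (F-covers b))
          (subst (λ i → b′ ∈ F i) (sym same-block) (proj₂ (F-covers b′))) (trans (sym fa≡fb) fa≡fb′)

    cover-lower-bound : ∀ {j} → Coverable P j → n ≤ 6 * j
    cover-lower-bound cov =
      quadruple-counting samePart (part-size≤ cov) _∙_ ∙-comm ∙-cancelˡ origin square-collides

n≤2^n : ∀ n → n ≤ 2 ^ n
n≤2^n zero    = z≤n
n≤2^n (suc n) = +-mono-≤ (m^n>0 2 n) (≤-trans (n≤2^n n) (m≤m+n (2 ^ n) 0))

log₂-bracket : ∀ d → 1 ≤ d → ∃ λ q → 2 ^ q ≤ d × d < 2 ^ suc q
log₂-bracket (suc zero)    _ = 0 , ≤-refl , s≤s (s≤s z≤n)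
log₂-bracket (suc (suc d)) _ with log₂-bracket (suc d) (s≤s z≤n)
... | q , 2^q≤1+d , 1+d<2^q+1 with m≤n⇒m<n∨m≡n 1+d<2^q+1
...   | inj₁ 2+d<2^q+1 = q , m≤n⇒m≤1+n 2^q≤1+d , 2+d<2^q+1
...   | inj₂ 2+d≡2^q+1 = suc q , ≤-reflexive (sym 2+d≡2^q+1) ,
  <-≤-trans (m<m+n (suc (suc d)) {suc (suc d) + 0} 0<1+n)
            (≤-reflexive (cong (λ t → t + (t + 0)) 2+d≡2^q+1))

module _ (q : ℕ) {d : ℕ} (d<2^q+1 : d < 2 ^ suc q) where

  16≤2^q : 17 ≤ d → 16 ≤ 2 ^ q
  16≤2^q 17≤d = ^-monoʳ-≤ 2 {4} {q} (≮⇒≥ λ q<4 →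
    <-irrefl refl (≤-trans 17≤d (<⇒≤ (<-≤-trans d<2^q+1 (^-monoʳ-≤ 2 {suc q} {4} q<4)))))

  12·2^d<2^[q+d] : 17 ≤ d → 6 * (2 * 2 ^ d) < 2 ^ (q + d)
  12·2^d<2^[q+d] 17≤d = begin-strict
    6 * (2 * 2 ^ d)  ≡⟨ *-assoc 6 2 (2 ^ d) ⟨
    12 * 2 ^ d       <⟨ *-monoˡ-< (2 ^ d) {{m^n≢0 2 d}} (m<m+n 12 {4} (s≤s z≤n)) ⟩
    16 * 2 ^ d       ≤⟨ *-monoˡ-≤ (2 ^ d) (16≤2^q 17≤d) ⟩
    2 ^ q * 2 ^ d    ≡⟨ ^-distribˡ-+-* 2 q d ⟨
    2 ^ (q + d)      ∎
    where open ≤-Reasoning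

  2^d·d≤12j : ∀ {j} → 2 ^ (q + d) ≤ 6 * j → 2 ^ d * d ≤ 12 * j
  2^d·d≤12j {j} n≤6j = begin
    2 ^ d * d              ≤⟨ *-monoʳ-≤ (2 ^ d) (<⇒≤ d<2^q+1) ⟩
    2 ^ d * (2 * 2 ^ q)    ≡⟨ rearrange (2 ^ d) (2 ^ q) ⟩
    2 * (2 ^ q * 2 ^ d)    ≡⟨ cong (2 *_) (^-distribˡ-+-* 2 q d) ⟨
    2 * 2 ^ (q + d)        ≤⟨ *-monoʳ-≤ 2 n≤6j ⟩
    2 * (6 * j)            ≡⟨ *-assoc 2 6 j ⟨
    12 * j                 ∎
    where
    open ≤-Reasoning
    rearrange : ∀ x y → x * (2 * y) ≡ 2 * (y * x)
    rearrange = solve-∀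

mainTheorem4 : ∃ λ (C : ℕ) → NonZero C ×
    (∀ (d : ℕ) → 17 ≤ d →
    ∃ λ (n : ℕ) → Σ (Matroid n) λ M → ∃ λ (k : ℕ) →
    HasRank M d × d ≤ k × Coverable M k ×
    (∀ (P : Matroid n) → IsPartitionMatroid P → IsReductionOf P M →
    ¬ Coverable P (2 * k)) ×
    (∀ (P : Matroid n) → IsPartitionMatroid P → IsReductionOf P M →
    ∀ (j : ℕ) → Coverable P j → k * d ≤ C * j))
mainTheorem4 = 12 , _ , λ d 17≤d →
  let q , 2^q≤d , d<2^q+1 = log₂-bracket d (≤-trans (s≤s z≤n) 17≤d)
      open Construction q d 2^q≤d
  in n , M , 2 ^ d , hasRank , n≤2^n d , cover ,
     (λ P partition reduction cov →
        <⇒≱ (12·2^d<2^[q+d] q d<2^q+1 17≤d) (cover-lower-bound P partition reduction cov)) ,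
     (λ P partition reduction j cov →
        2^d·d≤12j q d<2^q+1 {j} (cover-lower-bound P partition reduction cov))
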